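{- Let $n\ge 2$. Let $\mathcal{B}_{n,k}$ denote a set of representatives of the equivalence classes of binary LCD $[n,k]$ codes and $\mathcal{B}_{n,k,d}$ a set of representatives of the equivalence classes of binary LCD $[n,k,d]$ codes. Then: (i) $|\mathcal{B}_{n,1,d}|=1$ if $n$ is even and $d\in\{1,3,5,\dots,n-1\}$; $|\mathcal{B}_{n,1,d}|=1$ if $n$ is odd and $d\in\{1,3,5,\dots,n\}$; and $|\mathcal{B}_{n,1,d}|=0$ otherwise. (ii) $|\mathcal{B}_{n,1}|=|\mathcal{B}_{n,n-1}|=n/2$ if $n$ is even, and $=(n+1)/2$ if $n$ is odd. (iii) $|\mathcal{B}_{n,n-1,d}|=n/2$ if $n$ is even and $d=1$; $=(n-1)/2$ if $n$ is odd and $d=1$; $=1$ if $n$ is odd and $d=2$; and $=0$ otherwise.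
   Context: A binary $[n,k]$ code is a $k$-dimensional subspace of $\mathbb{F}_2^n$; an $[n,k,d]$ code is one whose minimum nonzero Hamming weight is $d$. Two binary codes are equivalent if one is obtained from the other by a permutation of coordinates (i.e. right multiplication by a monomial matrix). $C^\perp$ is the dual code with respect to the standard inner product; $C$ is LCD (linear complementary dual) if $C\cap C^\perp=\{\mathbf{0}_n\}$. -}

module Defs where

open import Data.Nat using (ℕ; zero; suc; _+_; _≤_; _<_)
open import Data.Bool using (Bool; true; false; _xor_; _∧_)
open import Data.Fin using (Fin)
open import Data.Fin.Permutation using (Permutation′; _⟨$⟩ʳ_)
open import Data.Vec using (Vec; []; _∷_; replicate; zipWith; tabulate; lookup; foldr)
open import Data.Product using (Σ; ∃; _×_; _,_)
open import Relation.Binary.PropositionalEquality using (_≡_)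
open import Relation.Nullary using (¬_)
open import Function.Bundles using (_⇔_)

-- Words of F₂ⁿ (true = 1, false = 0); addition is xor.
Word : ℕ → Set
Word n = Vec Bool n

𝟎 : ∀ {n} → Word n
𝟎 = replicate _ false

_⊕_ : ∀ {n} → Word n → Word n → Word n
_⊕_ = zipWith _xor_

dot : ∀ {n} → Word n → Word n → Bool
dot x y = foldr _ _xor_ false (zipWith _∧_ x y)

wt : ∀ {n} → Word n → ℕ
wt [] = 0
wt (true ∷ x) = suc (wt x)
wt (false ∷ x) = wt x

combo : ∀ {n k} → Vec Bool k → Vec (Word n) k → Word n
combo [] [] = 𝟎
combo (true ∷ c) (g ∷ G) = g ⊕ combo c G
combo (false ∷ c) (g ∷ G) = combo c G

Subset : ℕ → Set
Subset n = Word n → Bool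

_∈_ : ∀ {n} → Word n → Subset n → Set
x ∈ C = C x ≡ true

LinIndep : ∀ {n k} → Vec (Word n) k → Set
LinIndep {k = k} G = ∀ c → combo c G ≡ 𝟎 → c ≡ replicate k false

IsCode : (n k : ℕ) → Subset n → Set
IsCode n k C = Σ (Vec (Word n) k) λ G →
  LinIndep G × (∀ x → (x ∈ C) ⇔ (∃ λ c → combo c G ≡ x))

MinWeight : ∀ {n} → Subset n → ℕ → Set
MinWeight C d =
  (∃ λ x → x ∈ C × ¬ (x ≡ 𝟎) × wt x ≡ d) ×
  (∀ x → x ∈ C → ¬ (x ≡ 𝟎) → d ≤ wt x)

_∈⊥_ : ∀ {n} → Word n → Subset n → Set
x ∈⊥ C = ∀ y → y ∈ C → dot x y ≡ false

IsLCD : ∀ {n} → Subset n → Set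
IsLCD C = ∀ x → x ∈ C → x ∈⊥ C → x ≡ 𝟎

LCD[_,_] : (n k : ℕ) → Subset n → Set
LCD[ n , k ] C = IsCode n k C × IsLCD C

LCD[_,_,_] : (n k d : ℕ) → Subset n → Set
LCD[ n , k , d ] C = IsCode n k C × MinWeight C d × IsLCD C

permute : ∀ {n} → Permutation′ n → Word n → Word n
permute σ x = tabulate λ i → lookup x (σ ⟨$⟩ʳ i)

Equivalent : ∀ {n} → Subset n → Subset n → Set
Equivalent {n} C D = ∃ λ (σ : Permutation′ n) → ∀ x → (x ∈ D) ⇔ (permute σ x ∈ C)

-- The property P (a class of codes) has exactly m equivalence classes, i.e.
-- a set of representatives of its equivalence classes has m elements:
-- there are m pairwise inequivalent codes with property P such that every
-- code with property P is equivalent to one of them.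
NumClasses : ∀ {n} → (Subset n → Set) → ℕ → Set
NumClasses {n} P m = Σ (Fin m → Subset n) λ rep →
  (∀ i → P (rep i)) ×
  (∀ i j → Equivalent (rep i) (rep j) → i ≡ j) ×
  (∀ C → P C → ∃ λ i → Equivalent C (rep i))

module Submission where

-- A one-dimensional code is {0, g}, and it is LCD iff g · g = 1, i.e. iff wt g is odd. A code of
-- dimension n − 1 in F₂ⁿ is a subgroup of index 2, so the indicator of its complement is a linear
-- functional x ↦ h · x and the code is h⊥; it is LCD iff h · h = 1, again iff wt h is odd. Coordinate
-- permutations act on the defining word g or h, so in both cases a class is determined by an odd
-- weight w ≤ n and represented by 1ʷ0ⁿ⁻ʷ; there are ⌈n/2⌉ such weights. The minimum distance is
-- wt g for a line, and for h⊥ it is 1 unless h = 1ⁿ, when it is 2.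

open import Defs
open import Data.Nat using (ℕ; suc; s≤s; _+_; _∸_; _≤_; _/_)
open import Data.Nat.Divisibility using (_∣_)
open import Data.Product using (_×_)
open import Data.Sum using (_⊎_)
open import Relation.Binary.PropositionalEquality using (_≡_)
open import Relation.Nullary using (¬_)

-- The development lives in a module so that _,_ is out of scope at the statement, where it would make
-- LCD[ n , 1 , d ] ambiguous; for the same reason the lemmas write LCD[_,_,_] prefix.
module BinaryCodes where

  open import Algebra.Bundles using (AbelianGroup; CommutativeRing)
  open import Algebra.Structures using (IsAbelianGroup)
  import Algebra.Properties.AbelianGroup as AbelianGroupProperties
  import Algebra.Properties.CommutativeMonoid.Sum as CommutativeMonoidSum
  import Algebra.Properties.CommutativeSemigroup as CommutativeSemigroupProperties
  open import Data.Bool using (Bool; true; false; not; _xor_; _∧_; _∨_; if_then_else_)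
  open import Data.Bool.Properties
    using ( not-involutive; not-injective; not-¬; xor-same; xor-assoc; xor-comm; xor-identityˡ; xor-identityʳ
          ; ∧-comm; ∧-distribˡ-xor; xor-∧-commutativeRing)
    renaming (_≟_ to _≟ᵇ_)
  open import Data.Empty using (⊥-elim)
  open import Data.Fin using (Fin; toℕ; fromℕ<) renaming (zero to 0F; suc to 1+)
  open import Data.Fin.Permutation using (Permutation′; _⟨$⟩ʳ_; _⟨$⟩ˡ_; lift₀; transpose; flip; _∘ₚ_)
  import Data.Fin.Permutation as Permutation
  open import Data.Fin.Properties using (2↔Bool; pigeonhole; <⇒≢; toℕ-injective; toℕ-fromℕ<; toℕ<n)
  open import Data.Nat
    using (ℕ; zero; suc; _+_; _*_; _∸_; _/_; _^_; _≤_; _<_; _≤?_; s≤s; s≤s⁻¹; z≤n; pred; ⌊_/2⌋; ⌈_/2⌉)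
  open import Data.Nat.Divisibility using (_∣_; divides; _∣?_)
  open import Data.Nat.DivMod using (m/n≡1+[m∸n]/n)
  open import Data.Nat.Properties
    using ( ≤-refl; ≤-antisym; ≤⇒≯; <⇒≱; ≰⇒>; m≤n⇒m<n∨m≡n; m≤n⇒m≤1+n; n<1+n
          ; +-suc; +-identityʳ; +-comm; *-comm; ^-monoʳ-<; n≡⌊n+n/2⌋; n≡⌈n+n/2⌉; ⌈n/2⌉-mono; +-0-commutativeMonoid)
  open import Data.Product using (Σ; ∃; _×_; _,_; proj₁; map₂)
  open import Data.Sum using (_⊎_; inj₁; inj₂; [_,_]; [_,_]′) renaming (map to ⊎-map)
  open import Data.Sum.Function.Propositional using (_⊎-⇔_)
  open import Data.Vec using (Vec; []; _∷_; replicate; zipWith; map; tabulate; lookup)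
  open import Data.Vec.Properties
    using ( ≡-dec; ∷-injectiveʳ; tabulate∘lookup; lookup∘tabulate; tabulate-cong
          ; zipWith-assoc; zipWith-comm; zipWith-identityˡ; zipWith-identityʳ)
  open import Data.Vec.Recursive using (lift↔; Fin[m^n]↔Fin[m]^n)
  open import Data.Vec.Recursive.Properties using (↔Vec)
  open import Data.Vec.Relation.Unary.All using (All; []; _∷_; universal)
  open import Function using (id; _∘_; case_of_)
  open import Function.Bundles using (_↔_; Inverse; Equivalence; _⇔_; mk⇔)
  open import Function.Properties.Equivalence using () renaming (trans to ⇔-trans; sym to ⇔-sym)
  open import Function.Properties.Inverse using (↔-trans)
  open import Level using (0ℓ)
  open import Relation.Binary.Definitions using (DecidableEquality)
  open import Relation.Binary.PropositionalEquality
    using (_≡_; refl; sym; trans; cong; cong₂; subst; isEquivalence; module ≡-Reasoning)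
  open import Relation.Nullary using (¬_; does; yes; no)

  xor≡false⇒≡ : ∀ {a b} → a xor b ≡ false → a ≡ b
  xor≡false⇒≡ {true}  {true}  _ = refl
  xor≡false⇒≡ {false} {false} _ = refl

  ⇔⇒≡ : ∀ {a b} → (a ≡ true ⇔ b ≡ true) → a ≡ b
  ⇔⇒≡ {true}  {true}  _   = refl
  ⇔⇒≡ {true}  {false} a⇔b = sym (Equivalence.to a⇔b refl)
  ⇔⇒≡ {false} {true}  a⇔b = Equivalence.from a⇔b refl
  ⇔⇒≡ {false} {false} _   = refl

  isOdd : ℕ → Bool
  isOdd zero    = false
  isOdd (suc n) = not (isOdd n)

  isOdd-double : ∀ j → isOdd (j + j) ≡ false
  isOdd-double zero    = refl
  isOdd-double (suc j) = trans (cong (not ∘ isOdd) (+-suc j j)) (trans (not-involutive _) (isOdd-double j))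

  isOdd-suc-suc : ∀ n {b} → isOdd (suc (suc n)) ≡ b → isOdd n ≡ b
  isOdd-suc-suc n eq = trans (sym (not-involutive (isOdd n))) eq

  even⇒double-half : ∀ n → isOdd n ≡ false → ⌊ n /2⌋ + ⌊ n /2⌋ ≡ n
  even⇒double-half zero          _    = refl
  even⇒double-half (suc (suc n)) even =
    trans (cong suc (+-suc ⌊ n /2⌋ ⌊ n /2⌋)) (cong (suc ∘ suc) (even⇒double-half n (isOdd-suc-suc n even)))

  odd⇒double-half : ∀ n → isOdd n ≡ true → suc (⌊ n /2⌋ + ⌊ n /2⌋) ≡ n
  odd⇒double-half (suc zero)    _   = refl
  odd⇒double-half (suc (suc n)) odd =
    trans (cong (suc ∘ suc) (+-suc ⌊ n /2⌋ ⌊ n /2⌋)) (cong (suc ∘ suc) (odd⇒double-half n (isOdd-suc-suc n odd)))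

  double≡*2 : ∀ q → q + q ≡ q * 2
  double≡*2 q = trans (cong (q +_) (sym (+-identityʳ q))) (*-comm 2 q)

  2∣⇒even : ∀ {n} → 2 ∣ n → isOdd n ≡ false
  2∣⇒even (divides q refl) = trans (cong isOdd (sym (double≡*2 q))) (isOdd-double q)

  even⇒2∣ : ∀ {n} → isOdd n ≡ false → 2 ∣ n
  even⇒2∣ {n} even = divides ⌊ n /2⌋ (trans (sym (even⇒double-half n even)) (double≡*2 ⌊ n /2⌋))

  ∤⇒odd : ∀ {n} → ¬ 2 ∣ n → isOdd n ≡ true
  ∤⇒odd {n} ∤n with isOdd n in parity
  ... | true  = refl
  ... | false = ⊥-elim (∤n (even⇒2∣ parity))

  odd⇒∤ : ∀ {n} → isOdd n ≡ true → ¬ 2 ∣ n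
  odd⇒∤ odd 2∣n = not-¬ (2∣⇒even 2∣n) odd

  odd⇒1≤ : ∀ {n} → isOdd n ≡ true → 1 ≤ n
  odd⇒1≤ {suc _} _ = s≤s z≤n

  ⊕-self : ∀ {n} (x : Word n) → x ⊕ x ≡ 𝟎
  ⊕-self []      = refl
  ⊕-self (a ∷ x) = cong₂ _∷_ (xor-same a) (⊕-self x)

  ⊕-isAbelianGroup : ∀ n → IsAbelianGroup _≡_ (_⊕_ {n}) 𝟎 id
  ⊕-isAbelianGroup n = record
    { isGroup = record
      { isMonoid = record
        { isSemigroup = record
          { isMagma = record { isEquivalence = isEquivalence ; ∙-cong = cong₂ _⊕_ }
          ; assoc = zipWith-assoc xor-assoc
          }
        ; identity = zipWith-identityˡ xor-identityˡ , zipWith-identityʳ xor-identityʳ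
        }
      ; inverse = ⊕-self , ⊕-self
      ; ⁻¹-cong = id
      }
    ; comm = zipWith-comm xor-comm
    }

  ⊕-abelianGroup : ℕ → AbelianGroup 0ℓ 0ℓ
  ⊕-abelianGroup n = record { isAbelianGroup = ⊕-isAbelianGroup n }

  module ⊕ {n : ℕ} where
    open AbelianGroup (⊕-abelianGroup n) public
      using (assoc; identityˡ; identityʳ)
    open AbelianGroupProperties (⊕-abelianGroup n) public
      using (x∙y⁻¹≈ε⇒x≈y; x≈y⇒x∙y⁻¹≈ε; \\-leftDividesʳ; //-rightDividesʳ)
    open CommutativeSemigroupProperties (AbelianGroup.commutativeSemigroup (⊕-abelianGroup n)) public
      using (interchange)

  open CommutativeSemigroupProperties (CommutativeRing.+-commutativeSemigroup xor-∧-commutativeRing)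
    using () renaming (interchange to xor-interchange)

  infixr 25 _·_

  _·_ : ∀ {n} → Bool → Word n → Word n
  b · x = if b then x else 𝟎

  ·-distribʳ-xor : ∀ {n} a b (x : Word n) → (a xor b) · x ≡ a · x ⊕ b · x
  ·-distribʳ-xor true  true  x = sym (⊕-self x)
  ·-distribʳ-xor true  false x = sym (⊕.identityʳ x)
  ·-distribʳ-xor false b     x = sym (⊕.identityˡ (b · x))

  combo-∷ : ∀ {n k} b g (c : Vec Bool k) (G : Vec (Word n) k) →
    combo (b ∷ c) (g ∷ G) ≡ b · g ⊕ combo c G
  combo-∷ true  g c G = refl
  combo-∷ false g c G = sym (⊕.identityˡ _)

  combo-𝟎 : ∀ {n k} (G : Vec (Word n) k) → combo 𝟎 G ≡ 𝟎
  combo-𝟎 []      = refl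
  combo-𝟎 (g ∷ G) = combo-𝟎 G

  combo-⊕ : ∀ {n k} (c d : Vec Bool k) (G : Vec (Word n) k) →
    combo (c ⊕ d) G ≡ combo c G ⊕ combo d G
  combo-⊕ [] [] [] = sym (⊕.identityˡ 𝟎)
  combo-⊕ (a ∷ c) (b ∷ d) (g ∷ G) = begin
    combo ((a xor b) ∷ c ⊕ d) (g ∷ G)            ≡⟨ combo-∷ (a xor b) g (c ⊕ d) G ⟩
    (a xor b) · g ⊕ combo (c ⊕ d) G              ≡⟨ cong₂ _⊕_ (·-distribʳ-xor a b g) (combo-⊕ c d G) ⟩
    (a · g ⊕ b · g) ⊕ (combo c G ⊕ combo d G)     ≡⟨ ⊕.interchange (a · g) (b · g) _ _ ⟩
    (a · g ⊕ combo c G) ⊕ (b · g ⊕ combo d G)     ≡⟨ sym (cong₂ _⊕_ (combo-∷ a g c G) (combo-∷ b g d G)) ⟩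
    combo (a ∷ c) (g ∷ G) ⊕ combo (b ∷ d) (g ∷ G) ∎
    where open ≡-Reasoning

  combo-combo : ∀ {n k m} (c : Vec Bool m) (D : Vec (Word k) m) (G : Vec (Word n) k) →
    combo (combo c D) G ≡ combo c (map (λ d → combo d G) D)
  combo-combo []          []      G = combo-𝟎 G
  combo-combo (true ∷ c)  (d ∷ D) G =
    trans (combo-⊕ d (combo c D) G) (cong (combo d G ⊕_) (combo-combo c D G))
  combo-combo (false ∷ c) (d ∷ D) G = combo-combo c D G

  dot-comm : ∀ {n} (x y : Word n) → dot x y ≡ dot y x
  dot-comm []      []      = refl
  dot-comm (a ∷ x) (b ∷ y) = cong₂ _xor_ (∧-comm a b) (dot-comm x y)

  dot-𝟎ˡ : ∀ {n} (x : Word n) → dot 𝟎 x ≡ false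
  dot-𝟎ˡ []      = refl
  dot-𝟎ˡ (a ∷ x) = dot-𝟎ˡ x

  dot-𝟎ʳ : ∀ {n} (x : Word n) → dot x 𝟎 ≡ false
  dot-𝟎ʳ x = trans (dot-comm x 𝟎) (dot-𝟎ˡ x)

  dot-⊕ʳ : ∀ {n} (c x y : Word n) → dot c (x ⊕ y) ≡ dot c x xor dot c y
  dot-⊕ʳ []      []      []       = refl
  dot-⊕ʳ (a ∷ c) (b ∷ x) (b′ ∷ y) =
    trans (cong₂ _xor_ (∧-distribˡ-xor a b b′) (dot-⊕ʳ c x y))
          (xor-interchange (a ∧ b) (a ∧ b′) (dot c x) (dot c y))

  dot-self : ∀ {n} (x : Word n) → dot x x ≡ isOdd (wt x)
  dot-self []          = refl
  dot-self (true ∷ x)  = cong not (dot-self x)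
  dot-self (false ∷ x) = dot-self x

  dot-nondegenerate : ∀ {n} (x : Word n) → (∀ c → dot c x ≡ false) → x ≡ 𝟎
  dot-nondegenerate []      _  = refl
  dot-nondegenerate (a ∷ x) ⊥x = cong₂ _∷_ a≡false (dot-nondegenerate x (λ c → ⊥x (false ∷ c)))
    where
    a≡false : a ≡ false
    a≡false = trans (sym (xor-identityʳ a)) (trans (cong (a xor_) (sym (dot-𝟎ˡ x))) (⊥x (true ∷ 𝟎)))

  dot-injective : ∀ {n} (x y : Word n) → (∀ c → dot c x ≡ dot c y) → x ≡ y
  dot-injective x y eq = ⊕.x∙y⁻¹≈ε⇒x≈y x y (dot-nondegenerate (x ⊕ y) λ c →
    trans (dot-⊕ʳ c x y) (trans (cong (_xor dot c y) (eq c)) (xor-same (dot c y))))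

  combo-zipWith-∷ : ∀ {n k} (c a : Vec Bool k) (G : Vec (Word n) k) →
    combo c (zipWith _∷_ a G) ≡ dot c a ∷ combo c G
  combo-zipWith-∷ []          []      []      = refl
  combo-zipWith-∷ (true ∷ c)  (a ∷ A) (g ∷ G) = cong ((a ∷ g) ⊕_) (combo-zipWith-∷ c A G)
  combo-zipWith-∷ (false ∷ c) (a ∷ A) (g ∷ G) = combo-zipWith-∷ c A G

  units : ∀ n → Vec (Word n) n
  units zero    = []
  units (suc n) = (true ∷ 𝟎) ∷ zipWith _∷_ 𝟎 (units n)

  combo-units : ∀ {n} (c : Word n) → combo c (units n) ≡ c
  combo-units []                = refl
  combo-units {suc n} (b ∷ c)   = begin
    combo (b ∷ c) ((true ∷ 𝟎) ∷ zipWith _∷_ 𝟎 (units n))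
      ≡⟨ combo-∷ b (true ∷ 𝟎) c _ ⟩
    b · (true ∷ 𝟎) ⊕ combo c (zipWith _∷_ 𝟎 (units n))
      ≡⟨ cong (b · (true ∷ 𝟎) ⊕_) (combo-zipWith-∷ c 𝟎 (units n)) ⟩
    b · (true ∷ 𝟎) ⊕ (dot c 𝟎 ∷ combo c (units n))
      ≡⟨ cong₂ (λ z w → b · (true ∷ 𝟎) ⊕ (z ∷ w)) (dot-𝟎ʳ c) (combo-units c) ⟩
    b · (true ∷ 𝟎) ⊕ (false ∷ c)
      ≡⟨ set-head b ⟩
    b ∷ c
      ∎
    where
    open ≡-Reasoning
    set-head : ∀ b → b · (true ∷ 𝟎) ⊕ (false ∷ c) ≡ b ∷ c
    set-head true  = cong (true ∷_) (⊕.identityˡ c)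
    set-head false = cong (false ∷_) (⊕.identityˡ c)

  Additive : ∀ {n} → (Word n → Bool) → Set
  Additive f = ∀ x y → f (x ⊕ y) ≡ f x xor f y

  additive-combo : ∀ {n k} {f : Word n → Bool} → Additive f →
    ∀ (c : Vec Bool k) V → f (combo c V) ≡ dot c (map f V)
  additive-combo {f = f} add []          []      = begin
    f 𝟎           ≡⟨ cong f (sym (⊕.identityˡ 𝟎)) ⟩
    f (𝟎 ⊕ 𝟎)     ≡⟨ add 𝟎 𝟎 ⟩
    f 𝟎 xor f 𝟎   ≡⟨ xor-same (f 𝟎) ⟩
    false         ∎
    where open ≡-Reasoning
  additive-combo {f = f} add (true ∷ c)  (v ∷ V) =
    trans (add v (combo c V)) (cong (f v xor_) (additive-combo add c V))
  additive-combo         add (false ∷ c) (v ∷ V) = additive-combo add c V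

  additive⇒dot : ∀ {n} {f : Word n → Bool} → Additive f → ∀ x → f x ≡ dot (map f (units n)) x
  additive⇒dot {n} {f} add x = begin
    f x                         ≡⟨ cong f (sym (combo-units x)) ⟩
    f (combo x (units n))       ≡⟨ additive-combo add x (units n) ⟩
    dot x (map f (units n))     ≡⟨ dot-comm x _ ⟩
    dot (map f (units n)) x     ∎
    where open ≡-Reasoning

  Span : ∀ {n k} → Vec (Word n) k → Word n → Set
  Span G x = ∃ λ c → combo c G ≡ x

  Dependent : ∀ {n m} → Vec (Word n) m → Set
  Dependent H = ∃ λ c → ¬ c ≡ 𝟎 × combo c H ≡ 𝟎

  span-coefficients : ∀ {n k m} {G : Vec (Word n) k} {H : Vec (Word n) m} → All (Span G) H →
    Σ (Vec (Word k) m) λ D → map (λ d → combo d G) D ≡ H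
  span-coefficients []                = [] , refl
  span-coefficients ((d , eq) ∷ spans) with span-coefficients spans
  ... | D , eqD = d ∷ D , cong₂ _∷_ eq eqD

  Fin[2^k]↔Word : ∀ k → Fin (2 ^ k) ↔ Word k
  Fin[2^k]↔Word k = ↔-trans (Fin[m^n]↔Fin[m]^n 2 k) (↔-trans (lift↔ k 2↔Bool) (↔Vec k))

  word-pigeonhole : ∀ {k m} → k < m → (F : Word m → Word k) →
    ∃ λ c → ∃ λ c′ → ¬ c ≡ c′ × F c ≡ F c′
  word-pigeonhole {k} {m} k<m F
    with i , j , i<j , same-code ← pigeonhole (^-monoʳ-< 2 (s≤s (s≤s z≤n)) k<m)
                                     (Inverse.from (Fin[2^k]↔Word k) ∘ F ∘ Inverse.to (Fin[2^k]↔Word m))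
    = Eᵐ.to i , Eᵐ.to j , to-distinct , F-same
    where
    module Eᵐ = Inverse (Fin[2^k]↔Word m)
    module Eᵏ = Inverse (Fin[2^k]↔Word k)
    to-distinct : ¬ Eᵐ.to i ≡ Eᵐ.to j
    to-distinct eq = <⇒≢ i<j (trans (sym (Eᵐ.strictlyInverseʳ i)) (trans (cong Eᵐ.from eq) (Eᵐ.strictlyInverseʳ j)))
    F-same : F (Eᵐ.to i) ≡ F (Eᵐ.to j)
    F-same = trans (sym (Eᵏ.strictlyInverseˡ _)) (trans (cong Eᵏ.to same-code) (Eᵏ.strictlyInverseˡ _))

  span-dependent : ∀ {n k m} (G : Vec (Word n) k) (H : Vec (Word n) m) →
    k < m → All (Span G) H → Dependent H
  span-dependent G H k<m spans
    with D , refl ← span-coefficients spans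
    with c , c′ , c≢c′ , same ← word-pigeonhole k<m (λ c → combo c D)
    = c ⊕ c′ , c≢c′ ∘ ⊕.x∙y⁻¹≈ε⇒x≈y c c′ , (begin
    combo (c ⊕ c′) H                             ≡⟨ combo-⊕ c c′ H ⟩
    combo c H ⊕ combo c′ H                       ≡⟨ cong₂ _⊕_ (sym (combo-combo c D G)) (sym (combo-combo c′ D G)) ⟩
    combo (combo c D) G ⊕ combo (combo c′ D) G   ≡⟨ ⊕.x≈y⇒x∙y⁻¹≈ε (cong (λ e → combo e G) same) ⟩
    𝟎                                            ∎)
    where open ≡-Reasoning

  _≐_ : ∀ {n} → Subset n → Subset n → Set
  C ≐ D = ∀ x → C x ≡ D x

  ⟨_⟩⊥ : ∀ {n} → Word n → Subset n
  ⟨ h ⟩⊥ x = not (dot h x)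

  code-∋-combo : ∀ {n k} {C : Subset n} (code : IsCode n k C) c → combo c (proj₁ code) ∈ C
  code-∋-combo (G , _ , spanC) c = Equivalence.from (spanC (combo c G)) (c , refl)

  code-∈⇒span : ∀ {n k} {C : Subset n} (code : IsCode n k C) {x} → x ∈ C → Span (proj₁ code) x
  code-∈⇒span (G , _ , spanC) x∈C = Equivalence.to (spanC _) x∈C

  code-⊕-closed : ∀ {n k} {C : Subset n} → IsCode n k C → ∀ {x y} → x ∈ C → y ∈ C → (x ⊕ y) ∈ C
  code-⊕-closed {C = C} code x∈C y∈C
    with c , refl ← code-∈⇒span code x∈C
    with d , refl ← code-∈⇒span code y∈C
    = subst (_∈ C) (combo-⊕ c d (proj₁ code)) (code-∋-combo code (c ⊕ d))

  -- x, y and the n basis vectors are n + 2 words of length n + 1, hence dependent.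
  codim₁-index2 : ∀ {n} {C : Subset (suc n)} → IsCode (suc n) n C →
    ∀ {x y} → C x ≡ false → C y ≡ false → (x ⊕ y) ∈ C
  codim₁-index2 {n} {C} code@(G , indep , _) {x} {y} x∉C y∉C =
    from-dependency (span-dependent (units (suc n)) (x ∷ y ∷ G) (n<1+n (suc n)) (universal (λ z → z , combo-units z) _))
    where
    ∈C : ∀ {z} c → z ⊕ combo c G ≡ 𝟎 → z ∈ C
    ∈C c eq = subst (_∈ C) (sym (⊕.x∙y⁻¹≈ε⇒x≈y _ _ eq)) (code-∋-combo code c)
    from-dependency : Dependent (x ∷ y ∷ G) → (x ⊕ y) ∈ C
    from-dependency (false ∷ false ∷ c , nonzero , dependency) =
      ⊥-elim (nonzero (cong (λ c → false ∷ false ∷ c) (indep c dependency)))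
    from-dependency (true  ∷ false ∷ c , _ , dependency) = ⊥-elim (not-¬ x∉C (∈C c dependency))
    from-dependency (false ∷ true  ∷ c , _ , dependency) = ⊥-elim (not-¬ y∉C (∈C c dependency))
    from-dependency (true  ∷ true  ∷ c , _ , dependency) = ∈C c (trans (⊕.assoc x y _) dependency)

  index2⇒additive : ∀ {n} {C : Subset n} →
    (∀ {x y} → x ∈ C → y ∈ C → (x ⊕ y) ∈ C) →
    (∀ {x y} → C x ≡ false → C y ≡ false → (x ⊕ y) ∈ C) →
    Additive (not ∘ C)
  index2⇒additive {C = C} closed index2 x y with C x in cx | C y in cy | C (x ⊕ y) in cxy
  ... | true  | true  | _     = cong not (trans (sym cxy) (closed cx cy))
  ... | false | false | _     = cong not (trans (sym cxy) (index2 cx cy))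
  ... | true  | false | false = refl
  ... | false | true  | false = refl
  ... | true  | false | true  = ⊥-elim (not-¬ cy (subst (_∈ C) (⊕.\\-leftDividesʳ x y) (closed cx cxy)))
  ... | false | true  | true  = ⊥-elim (not-¬ cx (subst (_∈ C) (⊕.//-rightDividesʳ y x) (closed cxy cy)))

  codim₁-hyperplane : ∀ {n} {C : Subset (suc n)} → IsCode (suc n) n C → ∃ λ h → ¬ h ≡ 𝟎 × C ≐ ⟨ h ⟩⊥
  codim₁-hyperplane {n} {C} code = h , h≢𝟎 , C≐⟨h⟩⊥
    where
    h : Word (suc n)
    h = map (not ∘ C) (units (suc n))

    C≐⟨h⟩⊥ : C ≐ ⟨ h ⟩⊥
    C≐⟨h⟩⊥ x = trans (sym (not-involutive (C x)))
      (cong not (additive⇒dot (index2⇒additive (code-⊕-closed code) (codim₁-index2 code)) x))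

    C-full : h ≡ 𝟎 → ∀ u → u ∈ C
    C-full h≡𝟎 u = trans (C≐⟨h⟩⊥ u) (cong not (trans (cong (λ z → dot z u) h≡𝟎) (dot-𝟎ˡ u)))

    h≢𝟎 : ¬ h ≡ 𝟎
    h≢𝟎 h≡𝟎
      with c , c≢𝟎 , dependency ← span-dependent (proj₁ code) (units (suc n)) (n<1+n n)
                                    (universal (code-∈⇒span code ∘ C-full h≡𝟎) _)
      = c≢𝟎 (trans (sym (combo-units c)) dependency)

  wt-𝟎 : ∀ n → wt (𝟎 {n}) ≡ 0
  wt-𝟎 zero    = refl
  wt-𝟎 (suc n) = wt-𝟎 n

  wt≡0⇒≡𝟎 : ∀ {n} (x : Word n) → wt x ≡ 0 → x ≡ 𝟎
  wt≡0⇒≡𝟎 []          _  = refl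
  wt≡0⇒≡𝟎 (false ∷ x) eq = cong (false ∷_) (wt≡0⇒≡𝟎 x eq)

  wt≤n : ∀ {n} (x : Word n) → wt x ≤ n
  wt≤n []          = z≤n
  wt≤n (true ∷ x)  = s≤s (wt≤n x)
  wt≤n (false ∷ x) = m≤n⇒m≤1+n (wt≤n x)

  wt-nonzero : ∀ {n} {x : Word n} → ¬ x ≡ 𝟎 → 1 ≤ wt x
  wt-nonzero {x = x} x≢𝟎 with wt x in wx
  ... | zero  = ⊥-elim (x≢𝟎 (wt≡0⇒≡𝟎 x wx))
  ... | suc _ = s≤s z≤n

  wt≡1⇒≢𝟎 : ∀ {n} {x : Word n} → wt x ≡ 1 → ¬ x ≡ 𝟎
  wt≡1⇒≢𝟎 {n} wx refl with () ← trans (sym wx) (wt-𝟎 n)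

  odd-weight⇒≢𝟎 : ∀ {n} {x : Word n} → isOdd (wt x) ≡ true → ¬ x ≡ 𝟎
  odd-weight⇒≢𝟎 {n} odd refl = not-¬ (cong isOdd (wt-𝟎 n)) odd

  module ℕ-Sum = CommutativeMonoidSum +-0-commutativeMonoid
  module xor-Sum = CommutativeMonoidSum (CommutativeRing.+-commutativeMonoid xor-∧-commutativeRing)

  wt-tabulate : ∀ {n} (f : Fin n → Bool) → wt (tabulate f) ≡ ℕ-Sum.sum (λ i → if f i then 1 else 0)
  wt-tabulate {zero}  f = refl
  wt-tabulate {suc n} f with f 0F
  ... | true  = cong suc (wt-tabulate (f ∘ 1+))
  ... | false = wt-tabulate (f ∘ 1+)

  dot-tabulate : ∀ {n} (f g : Fin n → Bool) → dot (tabulate f) (tabulate g) ≡ xor-Sum.sum (λ i → f i ∧ g i)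
  dot-tabulate {zero}  f g = refl
  dot-tabulate {suc n} f g = cong ((f 0F ∧ g 0F) xor_) (dot-tabulate (f ∘ 1+) (g ∘ 1+))

  wt-permute : ∀ {n} (σ : Permutation′ n) (x : Word n) → wt (permute σ x) ≡ wt x
  wt-permute {n} σ x = begin
    wt (permute σ x)                ≡⟨ wt-tabulate (λ i → lookup x (σ ⟨$⟩ʳ i)) ⟩
    ℕ-Sum.sum (count ∘ (σ ⟨$⟩ʳ_))    ≡⟨ sym (ℕ-Sum.sum-permute count σ) ⟩
    ℕ-Sum.sum count                 ≡⟨ sym (wt-tabulate (lookup x)) ⟩
    wt (tabulate (lookup x))        ≡⟨ cong wt (tabulate∘lookup x) ⟩
    wt x                            ∎
    where
    open ≡-Reasoning
    count : Fin n → ℕ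
    count i = if lookup x i then 1 else 0

  dot-permute : ∀ {n} (σ : Permutation′ n) (x y : Word n) → dot (permute σ x) (permute σ y) ≡ dot x y
  dot-permute {n} σ x y = begin
    dot (permute σ x) (permute σ y)
      ≡⟨ dot-tabulate (λ i → lookup x (σ ⟨$⟩ʳ i)) (λ i → lookup y (σ ⟨$⟩ʳ i)) ⟩
    xor-Sum.sum (product ∘ (σ ⟨$⟩ʳ_))
      ≡⟨ sym (xor-Sum.sum-permute product σ) ⟩
    xor-Sum.sum product
      ≡⟨ sym (dot-tabulate (lookup x) (lookup y)) ⟩
    dot (tabulate (lookup x)) (tabulate (lookup y))
      ≡⟨ cong₂ dot (tabulate∘lookup x) (tabulate∘lookup y) ⟩
    dot x y
      ∎
    where
    open ≡-Reasoning
    product : Fin n → Bool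
    product i = lookup x i ∧ lookup y i

  permute-𝟎 : ∀ {n} (σ : Permutation′ n) → permute σ 𝟎 ≡ 𝟎
  permute-𝟎 {n} σ = wt≡0⇒≡𝟎 _ (trans (wt-permute σ 𝟎) (wt-𝟎 n))

  permute-∘ : ∀ {n} (ρ τ : Permutation′ n) x → permute (ρ ∘ₚ τ) x ≡ permute ρ (permute τ x)
  permute-∘ ρ τ x = tabulate-cong λ i → sym (lookup∘tabulate _ (ρ ⟨$⟩ʳ i))

  permute-flipʳ : ∀ {n} (τ : Permutation′ n) x → permute τ (permute (flip τ) x) ≡ x
  permute-flipʳ τ x = trans
    (tabulate-cong λ i → trans (lookup∘tabulate _ (τ ⟨$⟩ʳ i)) (cong (lookup x) (Permutation.inverseˡ τ)))
    (tabulate∘lookup x)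

  permute-flipˡ : ∀ {n} (τ : Permutation′ n) x → permute (flip τ) (permute τ x) ≡ x
  permute-flipˡ τ x = trans
    (tabulate-cong λ i → trans (lookup∘tabulate _ (τ ⟨$⟩ˡ i)) (cong (lookup x) (Permutation.inverseʳ τ)))
    (tabulate∘lookup x)

  ≡-permute-flip : ∀ {n} (τ : Permutation′ n) {x y} → (permute (flip τ) x ≡ y) ⇔ (x ≡ permute τ y)
  ≡-permute-flip τ {x} {y} = mk⇔
    (λ eq → trans (sym (permute-flipʳ τ x)) (cong (permute τ) eq))
    (λ eq → trans (cong (permute (flip τ)) eq) (permute-flipˡ τ y))

  block : ∀ n → ℕ → Word n
  block zero    _       = []
  block (suc n) zero    = false ∷ block n zero
  block (suc n) (suc w) = true ∷ block n w

  wt-block : ∀ {n w} → w ≤ n → wt (block n w) ≡ w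
  wt-block {zero}  z≤n     = refl
  wt-block {suc n} z≤n     = wt-block {n} z≤n
  wt-block {suc n} (s≤s p) = cong suc (wt-block p)

  block-shift : ∀ {n w} → w ≤ n → ∃ λ ρ → permute ρ (false ∷ block n w) ≡ block (suc n) w
  block-shift {n} z≤n = Permutation.id , tabulate∘lookup _
  block-shift {suc n} {suc w} (s≤s w≤n) with ρ , eq ← block-shift w≤n =
    lift₀ ρ ∘ₚ transpose 0F (1+ 0F) , (begin
    permute (lift₀ ρ ∘ₚ transpose 0F (1+ 0F)) (false ∷ true ∷ block n w)
      ≡⟨ permute-∘ (lift₀ ρ) (transpose 0F (1+ 0F)) (false ∷ true ∷ block n w) ⟩
    permute (lift₀ ρ) (permute (transpose 0F (1+ 0F)) (false ∷ true ∷ block n w))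
      ≡⟨ cong (λ z → permute (lift₀ ρ) (true ∷ false ∷ z)) (tabulate∘lookup (block n w)) ⟩
    true ∷ permute ρ (false ∷ block n w)
      ≡⟨ cong (true ∷_) eq ⟩
    true ∷ block (suc n) w
      ∎)
    where open ≡-Reasoning

  block-sort : ∀ {n} (x : Word n) → ∃ λ τ → permute τ x ≡ block n (wt x)
  block-sort []          = Permutation.id , refl
  block-sort (true ∷ x)  with τ , eq ← block-sort x = lift₀ τ , cong (true ∷_) eq
  block-sort (false ∷ x)
    with τ , eq ← block-sort x
    with ρ , eq′ ← block-shift (wt≤n x)
    = ρ ∘ₚ lift₀ τ
    , trans (permute-∘ ρ (lift₀ τ) (false ∷ x)) (trans (cong (λ z → permute ρ (false ∷ z)) eq) eq′)

  ≐-sym : ∀ {n} {C D : Subset n} → C ≐ D → D ≐ C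
  ≐-sym C≐D x = sym (C≐D x)

  isLCD-resp-≐ : ∀ {n} {C D : Subset n} → C ≐ D → IsLCD C → IsLCD D
  isLCD-resp-≐ C≐D lcd x x∈D x⊥D = lcd x (trans (C≐D x) x∈D) λ y y∈C → x⊥D y (trans (sym (C≐D y)) y∈C)

  minWeight-resp-≐ : ∀ {n} {C D : Subset n} {d} → C ≐ D → MinWeight C d → MinWeight D d
  minWeight-resp-≐ C≐D ((x , x∈C , x≢𝟎 , wx) , minimal) =
    (x , trans (sym (C≐D x)) x∈C , x≢𝟎 , wx) , λ y y∈D → minimal y (trans (C≐D y) y∈D)

  minWeight-unique : ∀ {n} {C : Subset n} {d d′} → MinWeight C d → MinWeight C d′ → d ≡ d′
  minWeight-unique ((x , x∈C , x≢𝟎 , wx) , minimal) ((x′ , x′∈C , x′≢𝟎 , wx′) , minimal′) =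
    ≤-antisym (subst (_ ≤_) wx′ (minimal x′ x′∈C x′≢𝟎)) (subst (_ ≤_) wx (minimal′ x x∈C x≢𝟎))

  equivalent-respˡ-≐ : ∀ {n} {C C′ D : Subset n} → C ≐ C′ → Equivalent C′ D → Equivalent C D
  equivalent-respˡ-≐ C≐C′ (σ , D⇔C′) = σ , λ x → subst (λ b → _ ⇔ b ≡ true) (sym (C≐C′ _)) (D⇔C′ x)

  equivalent-by : ∀ {n} {C D : Subset n} (σ : Permutation′ n) → (∀ x → D x ≡ C (permute σ x)) → Equivalent C D
  equivalent-by σ D≡Cσ = σ , λ x → mk⇔ (trans (sym (D≡Cσ x))) (trans (D≡Cσ x))

  _≟ʷ_ : ∀ {n} → DecidableEquality (Word n)
  _≟ʷ_ = ≡-dec _≟ᵇ_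

  ⟨_⟩ : ∀ {n} → Word n → Subset n
  ⟨ g ⟩ x = does (x ≟ʷ 𝟎) ∨ does (x ≟ʷ g)

  ∈⟨⟩⇔ : ∀ {n} (g x : Word n) → x ∈ ⟨ g ⟩ ⇔ (x ≡ 𝟎 ⊎ x ≡ g)
  ∈⟨⟩⇔ g x with x ≟ʷ 𝟎 | x ≟ʷ g
  ... | yes x≡𝟎 | _       = mk⇔ (λ _ → inj₁ x≡𝟎) (λ _ → refl)
  ... | no _    | yes x≡g = mk⇔ (λ _ → inj₂ x≡g) (λ _ → refl)
  ... | no x≢𝟎  | no x≢g  = mk⇔ (λ ()) [ ⊥-elim ∘ x≢𝟎 , ⊥-elim ∘ x≢g ]

  ∈⟨_⟩ : ∀ {n} (g : Word n) → g ∈ ⟨ g ⟩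
  ∈⟨ g ⟩ = Equivalence.from (∈⟨⟩⇔ g g) (inj₂ refl)

  span-singleton : ∀ {n} (g x : Word n) → Span (g ∷ []) x ⇔ (x ≡ 𝟎 ⊎ x ≡ g)
  span-singleton g x = mk⇔ to from
    where
    to : Span (g ∷ []) x → x ≡ 𝟎 ⊎ x ≡ g
    to (true ∷ [] , eq)  = inj₂ (trans (sym eq) (⊕.identityʳ g))
    to (false ∷ [] , eq) = inj₁ (sym eq)
    from : x ≡ 𝟎 ⊎ x ≡ g → Span (g ∷ []) x
    from (inj₁ eq) = false ∷ [] , sym eq
    from (inj₂ eq) = true ∷ [] , trans (⊕.identityʳ g) (sym eq)

  ⟨⟩-isCode : ∀ {n} {g : Word n} → ¬ g ≡ 𝟎 → IsCode n 1 ⟨ g ⟩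
  ⟨⟩-isCode {g = g} g≢𝟎 = g ∷ [] , independent , λ x → ⇔-trans (∈⟨⟩⇔ g x) (⇔-sym (span-singleton g x))
    where
    independent : LinIndep (g ∷ [])
    independent (true ∷ [])  g≡𝟎 = ⊥-elim (g≢𝟎 (trans (sym (⊕.identityʳ g)) g≡𝟎))
    independent (false ∷ []) _   = refl

  line-basis : ∀ {n} {C : Subset n} → IsCode n 1 C → ∃ λ g → ¬ g ≡ 𝟎 × C ≐ ⟨ g ⟩
  line-basis (g ∷ [] , independent , spanC) =
    g , g≢𝟎 , λ x → ⇔⇒≡ (⇔-trans (spanC x) (⇔-trans (span-singleton g x) (⇔-sym (∈⟨⟩⇔ g x))))
    where
    g≢𝟎 : ¬ g ≡ 𝟎
    g≢𝟎 g≡𝟎 with () ← independent (true ∷ []) (trans (⊕.identityʳ g) g≡𝟎)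

  ⟨⟩-isLCD : ∀ {n} {g : Word n} → isOdd (wt g) ≡ true → IsLCD ⟨ g ⟩
  ⟨⟩-isLCD {g = g} odd x x∈ x⊥ with Equivalence.to (∈⟨⟩⇔ g x) x∈
  ... | inj₁ x≡𝟎 = x≡𝟎
  ... | inj₂ refl = ⊥-elim (not-¬ (x⊥ x x∈) (trans (dot-self x) odd))

  ⟨⟩-isLCD⇒odd : ∀ {n} {g : Word n} → ¬ g ≡ 𝟎 → IsLCD ⟨ g ⟩ → isOdd (wt g) ≡ true
  ⟨⟩-isLCD⇒odd {g = g} g≢𝟎 lcd with isOdd (wt g) in parity
  ... | true  = refl
  ... | false =
    ⊥-elim (g≢𝟎 (lcd g ∈⟨ g ⟩ λ y y∈ → [ dot-with-𝟎 , dot-with-g ] (Equivalence.to (∈⟨⟩⇔ g y) y∈)))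
    where
    dot-with-𝟎 : ∀ {y} → y ≡ 𝟎 → dot g y ≡ false
    dot-with-𝟎 refl = dot-𝟎ʳ g
    dot-with-g : ∀ {y} → y ≡ g → dot g y ≡ false
    dot-with-g refl = trans (dot-self g) parity

  ⟨⟩-minWeight : ∀ {n} {g : Word n} → ¬ g ≡ 𝟎 → MinWeight ⟨ g ⟩ (wt g)
  ⟨⟩-minWeight {g = g} g≢𝟎 = (g , ∈⟨ g ⟩ , g≢𝟎 , refl) , minimal
    where
    minimal : ∀ x → x ∈ ⟨ g ⟩ → ¬ x ≡ 𝟎 → wt g ≤ wt x
    minimal x x∈ x≢𝟎 with Equivalence.to (∈⟨⟩⇔ g x) x∈
    ... | inj₁ x≡𝟎 = ⊥-elim (x≢𝟎 x≡𝟎)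
    ... | inj₂ refl = ≤-refl

  ⟨⟩-permute : ∀ {n} (τ : Permutation′ n) (g : Word n) → Equivalent ⟨ g ⟩ ⟨ permute τ g ⟩
  ⟨⟩-permute τ g = flip τ , λ x →
    ⇔-trans (∈⟨⟩⇔ (permute τ g) x)
      (⇔-trans (⇔-sym (zero-case ⊎-⇔ ≡-permute-flip τ)) (⇔-sym (∈⟨⟩⇔ g _)))
    where
    zero-case : ∀ {x} → (permute (flip τ) x ≡ 𝟎) ⇔ (x ≡ 𝟎)
    zero-case {x} = subst (λ z → (permute (flip τ) x ≡ 𝟎) ⇔ (x ≡ z)) (permute-𝟎 τ) (≡-permute-flip τ)

  ⟨⟩-equivalent⇒wt≡ : ∀ {n} {g g′ : Word n} → ¬ g′ ≡ 𝟎 → Equivalent ⟨ g ⟩ ⟨ g′ ⟩ → wt g ≡ wt g′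
  ⟨⟩-equivalent⇒wt≡ {n} {g} {g′} g′≢𝟎 (σ , g′-image)
    with Equivalence.to (∈⟨⟩⇔ g (permute σ g′)) (Equivalence.to (g′-image g′) ∈⟨ g′ ⟩)
  ... | inj₁ σg′≡𝟎 =
    ⊥-elim (g′≢𝟎 (wt≡0⇒≡𝟎 g′ (trans (sym (wt-permute σ g′)) (trans (cong wt σg′≡𝟎) (wt-𝟎 n)))))
  ... | inj₂ σg′≡g = trans (cong wt (sym σg′≡g)) (wt-permute σ g′)

  hyperplane-basis : ∀ {n} → Word n → Vec (Word (suc n)) n
  hyperplane-basis {n} h = zipWith _∷_ h (units n)

  combo-hyperplane-basis : ∀ {n} (h c : Word n) → combo c (hyperplane-basis h) ≡ dot c h ∷ c
  combo-hyperplane-basis {n} h c = trans (combo-zipWith-∷ c h (units n)) (cong (dot c h ∷_) (combo-units c))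

  ⟨⟩⊥-isCode : ∀ {n} (h : Word n) → IsCode (suc n) n ⟨ true ∷ h ⟩⊥
  ⟨⟩⊥-isCode h = hyperplane-basis h , independent , λ x → mk⇔ (to x) (from x)
    where
    independent : LinIndep (hyperplane-basis h)
    independent c eq = ∷-injectiveʳ (trans (sym (combo-hyperplane-basis h c)) eq)
    to : ∀ x → x ∈ ⟨ true ∷ h ⟩⊥ → Span (hyperplane-basis h) x
    to (x₀ ∷ x) x∈ = x , trans (combo-hyperplane-basis h x)
      (cong (_∷ x) (trans (dot-comm x h) (sym (xor≡false⇒≡ (not-injective x∈)))))
    from : ∀ x → Span (hyperplane-basis h) x → x ∈ ⟨ true ∷ h ⟩⊥
    from x (c , refl) rewrite combo-hyperplane-basis h c =
      cong not (trans (cong (dot c h xor_) (dot-comm h c)) (xor-same (dot c h)))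

  ⟨⟩⊥-dual : ∀ {n} (h : Word n) {x} → x ∈⊥ ⟨ true ∷ h ⟩⊥ → x ≡ 𝟎 ⊎ x ≡ true ∷ h
  ⟨⟩⊥-dual h {x₀ ∷ x} x⊥ = split x₀ x⊥-basis
    where
    x⊥-basis : ∀ c → (x₀ ∧ dot c h) xor dot x c ≡ false
    x⊥-basis c = subst (λ y → dot (x₀ ∷ x) y ≡ false) (combo-hyperplane-basis h c)
      (x⊥ (combo c (hyperplane-basis h)) (code-∋-combo (⟨⟩⊥-isCode h) c))
    split : ∀ b → (∀ c → (b ∧ dot c h) xor dot x c ≡ false) → b ∷ x ≡ 𝟎 ⊎ b ∷ x ≡ true ∷ h
    split false ⊥basis = inj₁ (cong (false ∷_) (dot-nondegenerate x λ c → trans (dot-comm c x) (⊥basis c)))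
    split true  ⊥basis = inj₂ (cong (true ∷_) (sym (dot-injective h x λ c →
      xor≡false⇒≡ (trans (cong (dot c h xor_) (dot-comm c x)) (⊥basis c)))))

  ⟨⟩⊥-isLCD : ∀ {n} (h : Word n) → isOdd (wt (true ∷ h)) ≡ true → IsLCD ⟨ true ∷ h ⟩⊥
  ⟨⟩⊥-isLCD h odd x x∈ x⊥ with ⟨⟩⊥-dual h x⊥
  ... | inj₁ x≡𝟎 = x≡𝟎
  ... | inj₂ refl = ⊥-elim (not-¬ (cong not (trans (dot-self x) odd)) x∈)

  ⟨⟩⊥-isLCD⇒odd : ∀ {n} {h : Word n} → ¬ h ≡ 𝟎 → IsLCD ⟨ h ⟩⊥ → isOdd (wt h) ≡ true
  ⟨⟩⊥-isLCD⇒odd {h = h} h≢𝟎 lcd with isOdd (wt h) in parity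
  ... | true  = refl
  ... | false = ⊥-elim (h≢𝟎 (lcd h (cong not (trans (dot-self h) parity)) λ y y∈ → not-injective y∈))

  ⟨⟩⊥-permute : ∀ {n} (τ : Permutation′ n) (h : Word n) → Equivalent ⟨ h ⟩⊥ ⟨ permute τ h ⟩⊥
  ⟨⟩⊥-permute τ h = equivalent-by {C = ⟨ h ⟩⊥} {D = ⟨ permute τ h ⟩⊥} (flip τ) λ x → cong not (begin
    dot (permute τ h) x                                  ≡⟨ cong (dot (permute τ h)) (sym (permute-flipʳ τ x)) ⟩
    dot (permute τ h) (permute τ (permute (flip τ) x))   ≡⟨ dot-permute τ h _ ⟩
    dot h (permute (flip τ) x)                           ∎)
    where open ≡-Reasoning

  ⟨⟩⊥-equivalent⇒wt≡ : ∀ {n} {h h′ : Word n} → Equivalent ⟨ h ⟩⊥ ⟨ h′ ⟩⊥ → wt h ≡ wt h′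
  ⟨⟩⊥-equivalent⇒wt≡ {n} {h} {h′} (σ , h′⊥⇔) =
    trans (sym (wt-permute (flip σ) h)) (cong wt (dot-injective σ⁻¹h h′ λ x → begin
      dot x σ⁻¹h                                    ≡⟨ dot-comm x σ⁻¹h ⟩
      dot σ⁻¹h x                                    ≡⟨ cong (dot σ⁻¹h) (sym (permute-flipˡ σ x)) ⟩
      dot σ⁻¹h (permute (flip σ) (permute σ x))     ≡⟨ dot-permute (flip σ) h _ ⟩
      dot h (permute σ x)                           ≡⟨ not-injective (sym (⇔⇒≡ (h′⊥⇔ x))) ⟩
      dot h′ x                                      ≡⟨ dot-comm h′ x ⟩
      dot x h′                                      ∎))
    where
    open ≡-Reasoning
    σ⁻¹h : Word n
    σ⁻¹h = permute (flip σ) h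

  unit-outside-support : ∀ {n} (h : Word n) → wt h < n → ∃ λ e → wt e ≡ 1 × dot h e ≡ false
  unit-outside-support {suc n} (false ∷ h) _         = true ∷ 𝟎 , cong suc (wt-𝟎 n) , dot-𝟎ʳ h
  unit-outside-support         (true ∷ h)  (s≤s h<n) with e , we , he ← unit-outside-support h h<n =
    false ∷ e , we , he

  ⟨⟩⊥-minWeight₁ : ∀ {n} {h : Word n} → wt h < n → MinWeight ⟨ h ⟩⊥ 1
  ⟨⟩⊥-minWeight₁ {h = h} wh<n with e , we , he ← unit-outside-support h wh<n =
    (e , cong not he , wt≡1⇒≢𝟎 we , we) , λ x _ → wt-nonzero

  ones : ∀ n → Word n
  ones n = replicate n true

  dot-ones : ∀ {n} (x : Word n) → dot (ones n) x ≡ isOdd (wt x)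
  dot-ones []          = refl
  dot-ones (true ∷ x)  = cong not (dot-ones x)
  dot-ones (false ∷ x) = dot-ones x

  wt≡n⇒ones : ∀ {n} (x : Word n) → wt x ≡ n → x ≡ ones n
  wt≡n⇒ones []          _  = refl
  wt≡n⇒ones (true ∷ x)  wx = cong (true ∷_) (wt≡n⇒ones x (cong pred wx))
  wt≡n⇒ones {suc n} (false ∷ x) wx with () ← ≤⇒≯ (wt≤n x) (subst (suc n ≤_) (sym wx) ≤-refl)

  ⟨ones⟩⊥-minWeight : ∀ {n} → 2 ≤ n → MinWeight ⟨ ones n ⟩⊥ 2
  ⟨ones⟩⊥-minWeight {suc zero}    (s≤s ())
  ⟨ones⟩⊥-minWeight {suc (suc n)} _        =
    (true ∷ true ∷ 𝟎 , cong (not ∘ not ∘ not) (dot-𝟎ʳ (ones n)) , (λ ()) , cong (suc ∘ suc) (wt-𝟎 n))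
    , minimal
    where
    minimal : ∀ x → x ∈ ⟨ ones (suc (suc n)) ⟩⊥ → ¬ x ≡ 𝟎 → 2 ≤ wt x
    minimal x x∈ x≢𝟎 with wt x in wx
    ... | zero          = ⊥-elim (x≢𝟎 (wt≡0⇒≡𝟎 x wx))
    ... | suc zero      = ⊥-elim (not-¬ (cong not (trans (dot-ones x) (cong isOdd wx))) x∈)
    ... | suc (suc _)   = s≤s (s≤s z≤n)

  ⟨⟩⊥-minWeight-cases : ∀ {n} (h : Word (suc n)) → 1 ≤ n →
    (wt h ≤ n × MinWeight ⟨ h ⟩⊥ 1) ⊎ (wt h ≡ suc n × MinWeight ⟨ h ⟩⊥ 2)
  ⟨⟩⊥-minWeight-cases h 1≤n with m≤n⇒m<n∨m≡n (wt≤n h)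
  ... | inj₁ wh<1+n = inj₁ (s≤s⁻¹ wh<1+n , ⟨⟩⊥-minWeight₁ {h = h} wh<1+n)
  ... | inj₂ wh≡1+n = inj₂ (wh≡1+n ,
    subst (λ g → MinWeight ⟨ g ⟩⊥ 2) (sym (wt≡n⇒ones h wh≡1+n)) (⟨ones⟩⊥-minWeight (s≤s 1≤n)))

  even⇒⌈n/2⌉≡⌊n/2⌋ : ∀ n → isOdd n ≡ false → ⌈ n /2⌉ ≡ ⌊ n /2⌋
  even⇒⌈n/2⌉≡⌊n/2⌋ zero          _    = refl
  even⇒⌈n/2⌉≡⌊n/2⌋ (suc (suc n)) even = cong suc (even⇒⌈n/2⌉≡⌊n/2⌋ n (isOdd-suc-suc n even))

  ⌊n/2⌋≡n/2 : ∀ n → ⌊ n /2⌋ ≡ n / 2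
  ⌊n/2⌋≡n/2 zero          = refl
  ⌊n/2⌋≡n/2 (suc zero)    = refl
  ⌊n/2⌋≡n/2 (suc (suc n)) =
    trans (cong suc (⌊n/2⌋≡n/2 n)) (sym (m/n≡1+[m∸n]/n {suc (suc n)} {2} (s≤s (s≤s z≤n))))

  ⌈n/2⌉≡[n+1]/2 : ∀ n → ⌈ n /2⌉ ≡ (n + 1) / 2
  ⌈n/2⌉≡[n+1]/2 n = trans (⌊n/2⌋≡n/2 (suc n)) (cong (_/ 2) (+-comm 1 n))

  2∣⇒⌈n/2⌉≡n/2 : ∀ {n} → 2 ∣ n → ⌈ n /2⌉ ≡ n / 2
  2∣⇒⌈n/2⌉≡n/2 {n} 2∣n = trans (even⇒⌈n/2⌉≡⌊n/2⌋ n (2∣⇒even 2∣n)) (⌊n/2⌋≡n/2 n)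

  1+2j≤⇒<⌈/2⌉ : ∀ {j b} → suc (j + j) ≤ b → j < ⌈ b /2⌉
  1+2j≤⇒<⌈/2⌉ {j} {b} le = subst (_≤ ⌈ b /2⌉) (cong suc (sym (n≡⌊n+n/2⌋ j))) (⌈n/2⌉-mono le)

  <⌈/2⌉⇒1+2j≤ : ∀ {j b} → j < ⌈ b /2⌉ → suc (j + j) ≤ b
  <⌈/2⌉⇒1+2j≤ {j} {b} j<⌈b/2⌉ with suc (j + j) ≤? b
  ... | yes le = le
  ... | no ≰   = ⊥-elim (<⇒≱ j<⌈b/2⌉ (subst (⌈ b /2⌉ ≤_) (sym (n≡⌈n+n/2⌉ j)) (⌈n/2⌉-mono (s≤s⁻¹ (≰⇒> ≰)))))

  record Enumeration (V : ℕ → Set) (m : ℕ) : Set where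
    field
      enum      : Fin m → ℕ
      valid     : ∀ i → V (enum i)
      onto      : ∀ {w} → V w → ∃ λ i → enum i ≡ w
      injective : ∀ {i j} → enum i ≡ enum j → i ≡ j

  singleton-enumeration : ∀ d → Enumeration (_≡ d) 1
  singleton-enumeration d = record
    { enum = λ _ → d ; valid = λ _ → refl ; onto = λ w≡d → 0F , sym w≡d ; injective = λ { {0F} {0F} _ → refl } }

  odd≤-enumeration : ∀ b → Enumeration (λ w → isOdd w ≡ true × w ≤ b) ⌈ b /2⌉
  odd≤-enumeration b = record
    { enum      = λ i → suc (toℕ i + toℕ i)
    ; valid     = λ i → cong not (isOdd-double (toℕ i)) , <⌈/2⌉⇒1+2j≤ (toℕ<n i)
    ; onto      = onto
    ; injective = λ eq →
        toℕ-injective (trans (n≡⌊n+n/2⌋ _) (trans (cong (⌊_/2⌋ ∘ pred) eq) (sym (n≡⌊n+n/2⌋ _))))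
    }
    where
    onto : ∀ {w} → isOdd w ≡ true × w ≤ b → ∃ λ (i : Fin ⌈ b /2⌉) → suc (toℕ i + toℕ i) ≡ w
    onto {w} (odd , w≤b) =
      fromℕ< h<⌈b/2⌉ , trans (cong (λ j → suc (j + j)) (toℕ-fromℕ< h<⌈b/2⌉)) (odd⇒double-half w odd)
      where
      h<⌈b/2⌉ : ⌊ w /2⌋ < ⌈ b /2⌉
      h<⌈b/2⌉ = 1+2j≤⇒<⌈/2⌉ (subst (_≤ b) (sym (odd⇒double-half w odd)) w≤b)

  numClasses-byInvariant : ∀ {n m} {P : Subset n → Set} {V : ℕ → Set} (R : ℕ → Subset n) → Enumeration V m →
    (∀ {w} → V w → P (R w)) →
    (∀ {w w′} → V w → V w′ → Equivalent (R w) (R w′) → w ≡ w′) →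
    (∀ C → P C → ∃ λ w → V w × Equivalent C (R w)) →
    NumClasses P m
  numClasses-byInvariant R E P-R separated classify =
    R ∘ enum , P-R ∘ valid , (λ i j eq → injective (separated (valid i) (valid j) eq)) , represent
    where
    open Enumeration E
    represent : ∀ C → _ → ∃ λ i → Equivalent C (R (enum i))
    represent C pC with w , vw , C~Rw ← classify C pC with i , refl ← onto vw = i , C~Rw

  numClasses-none : ∀ {n} {P : Subset n → Set} → (∀ C → ¬ P C) → NumClasses P 0
  numClasses-none ¬P = (λ ()) , (λ ()) , (λ ()) , λ C pC → ⊥-elim (¬P C pC)

  lcdLine-classification : ∀ {n} {C : Subset n} → LCD[_,_] n 1 C →
    ∃ λ w → (isOdd w ≡ true × w ≤ n) × Equivalent C ⟨ block n w ⟩ × MinWeight C w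
  lcdLine-classification (code , lcd)
    with g , g≢𝟎 , C≐⟨g⟩ ← line-basis code
    with τ , τg≡block ← block-sort g
    = wt g , (⟨⟩-isLCD⇒odd g≢𝟎 (isLCD-resp-≐ C≐⟨g⟩ lcd) , wt≤n g)
    , equivalent-respˡ-≐ C≐⟨g⟩ (subst (Equivalent ⟨ g ⟩ ∘ ⟨_⟩) τg≡block (⟨⟩-permute τ g))
    , minWeight-resp-≐ (≐-sym C≐⟨g⟩) (⟨⟩-minWeight g≢𝟎)

  block-line-isLCD : ∀ {n w} → isOdd w ≡ true → w ≤ n → LCD[_,_,_] n 1 w ⟨ block n w ⟩
  block-line-isLCD {n} {w} odd w≤n =
    ⟨⟩-isCode g≢𝟎 , subst (MinWeight ⟨ block n w ⟩) (wt-block w≤n) (⟨⟩-minWeight g≢𝟎) , ⟨⟩-isLCD odd-g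
    where
    odd-g : isOdd (wt (block n w)) ≡ true
    odd-g = trans (cong isOdd (wt-block w≤n)) odd
    g≢𝟎 : ¬ block n w ≡ 𝟎
    g≢𝟎 = odd-weight⇒≢𝟎 odd-g

  block-lines-inequivalent : ∀ {n w w′} → w ≤ n → w′ ≤ n → isOdd w′ ≡ true →
    Equivalent ⟨ block n w ⟩ ⟨ block n w′ ⟩ → w ≡ w′
  block-lines-inequivalent {n} {w} {w′} w≤n w′≤n odd′ equiv =
    trans (sym (wt-block w≤n)) (trans (⟨⟩-equivalent⇒wt≡ g′≢𝟎 equiv) (wt-block w′≤n))
    where
    g′≢𝟎 : ¬ block n w′ ≡ 𝟎
    g′≢𝟎 = odd-weight⇒≢𝟎 (trans (cong isOdd (wt-block w′≤n)) odd′)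

  lcdLine-weight : ∀ {n d} {C : Subset n} → LCD[_,_,_] n 1 d C → isOdd d ≡ true × d ≤ n
  lcdLine-weight (code , md , lcd) with w , valid , _ , mw ← lcdLine-classification (code , lcd)
    rewrite minWeight-unique md mw = valid

  lcdLine-count : ∀ n → NumClasses (LCD[_,_] n 1) ⌈ n /2⌉
  lcdLine-count n = numClasses-byInvariant (⟨_⟩ ∘ block n) (odd≤-enumeration n)
    (λ (odd , w≤n) → let (code , _ , lcd) = block-line-isLCD odd w≤n in code , lcd)
    (λ (_ , w≤n) (odd′ , w′≤n) → block-lines-inequivalent w≤n w′≤n odd′)
    (λ C lcd → let (w , valid , C~ , _) = lcdLine-classification lcd in w , valid , C~)

  lcdLine-weight-count : ∀ {n d} → isOdd d ≡ true → d ≤ n → NumClasses (LCD[_,_,_] n 1 d) 1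
  lcdLine-weight-count {n} {d} odd d≤n = numClasses-byInvariant (λ _ → ⟨ block n d ⟩) (singleton-enumeration d)
    (λ _ → block-line-isLCD odd d≤n) (λ w≡d w′≡d _ → trans w≡d (sym w′≡d)) classify
    where
    classify : ∀ C → LCD[_,_,_] n 1 d C → ∃ λ w → w ≡ d × Equivalent C ⟨ block n d ⟩
    classify C (code , md , lcd) with w , _ , C~ , mw ← lcdLine-classification (code , lcd)
      rewrite minWeight-unique md mw = w , refl , C~

  lcdHyperplane-classification : ∀ {n} {C : Subset (suc n)} → 1 ≤ n → LCD[_,_] (suc n) n C →
    ∃ λ w → (isOdd w ≡ true × w ≤ suc n) × Equivalent C ⟨ block (suc n) w ⟩⊥ ×
            ((w ≤ n × MinWeight C 1) ⊎ (w ≡ suc n × MinWeight C 2))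
  lcdHyperplane-classification 1≤n (code , lcd)
    with h , h≢𝟎 , C≐⟨h⟩⊥ ← codim₁-hyperplane code
    with τ , τh≡block ← block-sort h
    = wt h , (⟨⟩⊥-isLCD⇒odd h≢𝟎 (isLCD-resp-≐ C≐⟨h⟩⊥ lcd) , wt≤n h)
    , equivalent-respˡ-≐ C≐⟨h⟩⊥ (subst (Equivalent ⟨ h ⟩⊥ ∘ ⟨_⟩⊥) τh≡block (⟨⟩⊥-permute τ h))
    , ⊎-map (map₂ (minWeight-resp-≐ (≐-sym C≐⟨h⟩⊥))) (map₂ (minWeight-resp-≐ (≐-sym C≐⟨h⟩⊥)))
            (⟨⟩⊥-minWeight-cases h 1≤n)

  block-hyperplane-isLCD : ∀ {n w} → isOdd w ≡ true → w ≤ suc n → LCD[_,_] (suc n) n ⟨ block (suc n) w ⟩⊥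
  block-hyperplane-isLCD {n} {suc w} odd w≤1+n =
    ⟨⟩⊥-isCode (block n w) , ⟨⟩⊥-isLCD (block n w) (trans (cong isOdd (wt-block w≤1+n)) odd)

  block-hyperplanes-inequivalent : ∀ {n w w′} → w ≤ n → w′ ≤ n →
    Equivalent ⟨ block n w ⟩⊥ ⟨ block n w′ ⟩⊥ → w ≡ w′
  block-hyperplanes-inequivalent {n} {w} {w′} w≤n w′≤n equiv =
    trans (sym (wt-block w≤n)) (trans (⟨⟩⊥-equivalent⇒wt≡ {h = block n w} {block n w′} equiv) (wt-block w′≤n))

  lcdHyperplane-distance : ∀ {n d} {C : Subset (suc n)} → 1 ≤ n → LCD[_,_,_] (suc n) n d C →
    d ≡ 1 ⊎ (isOdd (suc n) ≡ true × d ≡ 2)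
  lcdHyperplane-distance 1≤n (code , md , lcd) =
    let (_ , (odd , _) , _ , cases) = lcdHyperplane-classification 1≤n (code , lcd) in
    [ (λ (_ , m1) → inj₁ (minWeight-unique md m1))
    , (λ (w≡1+n , m2) → inj₂ (subst (λ v → isOdd v ≡ true) w≡1+n odd , minWeight-unique md m2))
    ]′ cases

  lcdHyperplane-count : ∀ {n} → 1 ≤ n → NumClasses (LCD[_,_] (suc n) n) ⌈ suc n /2⌉
  lcdHyperplane-count {n} 1≤n = numClasses-byInvariant (⟨_⟩⊥ ∘ block (suc n)) (odd≤-enumeration (suc n))
    (λ (odd , w≤1+n) → block-hyperplane-isLCD odd w≤1+n)
    (λ (_ , w≤1+n) (_ , w′≤1+n) → block-hyperplanes-inequivalent w≤1+n w′≤1+n)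
    (λ C lcd → let (w , valid , C~ , _) = lcdHyperplane-classification 1≤n lcd in w , valid , C~)

  lcdHyperplane-distance₁-count : ∀ {n} → 1 ≤ n → NumClasses (LCD[_,_,_] (suc n) n 1) ⌈ n /2⌉
  lcdHyperplane-distance₁-count {n} 1≤n = numClasses-byInvariant (⟨_⟩⊥ ∘ block (suc n)) (odd≤-enumeration n)
    representative
    (λ (_ , w≤n) (_ , w′≤n) → block-hyperplanes-inequivalent (m≤n⇒m≤1+n w≤n) (m≤n⇒m≤1+n w′≤n))
    classify
    where
    representative : ∀ {w} → isOdd w ≡ true × w ≤ n → LCD[_,_,_] (suc n) n 1 ⟨ block (suc n) w ⟩⊥
    representative {w} (odd , w≤n) with code , lcd ← block-hyperplane-isLCD odd (m≤n⇒m≤1+n w≤n) =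
      code , ⟨⟩⊥-minWeight₁ {h = block (suc n) w} (subst (_< suc n) (sym (wt-block (m≤n⇒m≤1+n w≤n))) (s≤s w≤n))
      , lcd
    classify : ∀ C → LCD[_,_,_] (suc n) n 1 C →
      ∃ λ w → (isOdd w ≡ true × w ≤ n) × Equivalent C ⟨ block (suc n) w ⟩⊥
    classify C (code , m1 , lcd) =
      let (w , (odd , _) , C~ , cases) = lcdHyperplane-classification 1≤n (code , lcd) in
      w , (odd , [ proj₁ , (λ (_ , m2) → case minWeight-unique m1 m2 of λ ()) ]′ cases) , C~

  lcdHyperplane-distance₂-count : ∀ {n} → 1 ≤ n → isOdd (suc n) ≡ true →
    NumClasses (LCD[_,_,_] (suc n) n 2) 1
  lcdHyperplane-distance₂-count {n} 1≤n odd =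
    numClasses-byInvariant (λ _ → ⟨ block (suc n) (suc n) ⟩⊥) (singleton-enumeration (suc n))
    (λ _ → representative) (λ w≡ w′≡ _ → trans w≡ (sym w′≡)) classify
    where
    representative : LCD[_,_,_] (suc n) n 2 ⟨ block (suc n) (suc n) ⟩⊥
    representative with code , lcd ← block-hyperplane-isLCD odd ≤-refl =
      code
      , subst (λ g → MinWeight ⟨ g ⟩⊥ 2) (sym (wt≡n⇒ones (block (suc n) (suc n)) (wt-block ≤-refl)))
              (⟨ones⟩⊥-minWeight (s≤s 1≤n))
      , lcd
    classify : ∀ C → LCD[_,_,_] (suc n) n 2 C → ∃ λ w → w ≡ suc n × Equivalent C ⟨ block (suc n) (suc n) ⟩⊥
    classify C (code , m2 , lcd) =
      let (w , _ , C~ , cases) = lcdHyperplane-classification 1≤n (code , lcd) in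
      suc n , refl ,
      [ (λ (_ , m1) → case minWeight-unique m1 m2 of λ ())
      , (λ (w≡1+n , _) → subst (Equivalent C ∘ ⟨_⟩⊥ ∘ block (suc n)) w≡1+n C~)
      ]′ cases

  odd-weight-admissible : ∀ {N d} → isOdd d ≡ true → d ≤ N →
    (2 ∣ N × ¬ 2 ∣ d × 1 ≤ d × d ≤ N ∸ 1) ⊎ (¬ 2 ∣ N × ¬ 2 ∣ d × 1 ≤ d × d ≤ N)
  odd-weight-admissible {N} odd d≤N with 2 ∣? N
  ... | no ∤N  = inj₂ (∤N , odd⇒∤ odd , odd⇒1≤ odd , d≤N)
  ... | yes 2∣N with m≤n⇒m<n∨m≡n d≤N
  ...   | inj₁ (s≤s d≤N∸1) = inj₁ (2∣N , odd⇒∤ odd , odd⇒1≤ odd , d≤N∸1)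
  ...   | inj₂ refl        = ⊥-elim (odd⇒∤ odd 2∣N)

  distance-admissible : ∀ {N d} → d ≡ 1 ⊎ (isOdd N ≡ true × d ≡ 2) →
    (2 ∣ N × d ≡ 1) ⊎ (¬ 2 ∣ N × d ≡ 1) ⊎ (¬ 2 ∣ N × d ≡ 2)
  distance-admissible {N} (inj₁ d≡1) with 2 ∣? N
  ... | yes 2∣N = inj₁ (2∣N , d≡1)
  ... | no ∤N   = inj₂ (inj₁ (∤N , d≡1))
  distance-admissible (inj₂ (odd , d≡2)) = inj₂ (inj₂ (odd⇒∤ odd , d≡2))

open BinaryCodes

proposition3p1 : (n : ℕ) → 2 ≤ n →
  -- (i)
  ((d : ℕ) → 2 ∣ n → ¬ (2 ∣ d) → 1 ≤ d → d ≤ n ∸ 1 → NumClasses LCD[ n , 1 , d ] 1) ×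
  ((d : ℕ) → ¬ (2 ∣ n) → ¬ (2 ∣ d) → 1 ≤ d → d ≤ n → NumClasses LCD[ n , 1 , d ] 1) ×
  ((d : ℕ) → ¬ ((2 ∣ n × ¬ (2 ∣ d) × 1 ≤ d × d ≤ n ∸ 1) ⊎ (¬ (2 ∣ n) × ¬ (2 ∣ d) × 1 ≤ d × d ≤ n))
    → NumClasses LCD[ n , 1 , d ] 0) ×
  -- (ii)
  (2 ∣ n → NumClasses LCD[ n , 1 ] (n / 2) × NumClasses LCD[ n , n ∸ 1 ] (n / 2)) ×
  (¬ (2 ∣ n) → NumClasses LCD[ n , 1 ] ((n + 1) / 2) × NumClasses LCD[ n , n ∸ 1 ] ((n + 1) / 2)) ×
  -- (iii)
  (2 ∣ n → NumClasses LCD[ n , n ∸ 1 , 1 ] (n / 2)) ×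
  (¬ (2 ∣ n) → NumClasses LCD[ n , n ∸ 1 , 1 ] ((n ∸ 1) / 2)) ×
  (¬ (2 ∣ n) → NumClasses LCD[ n , n ∸ 1 , 2 ] 1) ×
  ((d : ℕ) → ¬ ((2 ∣ n × d ≡ 1) ⊎ (¬ (2 ∣ n) × d ≡ 1) ⊎ (¬ (2 ∣ n) × d ≡ 2))
    → NumClasses LCD[ n , n ∸ 1 , d ] 0)
proposition3p1 (suc n) (s≤s 1≤n) =
    (λ d _ ∤d _ d≤n → lcdLine-weight-count (∤⇒odd ∤d) (m≤n⇒m≤1+n d≤n))
  , (λ d _ ∤d _ d≤1+n → lcdLine-weight-count (∤⇒odd ∤d) d≤1+n)
  , (λ d excluded → numClasses-none λ C lcd → excluded (uncurry odd-weight-admissible (lcdLine-weight lcd)))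
  , (λ 2∣ → subst (NumClasses _) (2∣⇒⌈n/2⌉≡n/2 2∣) (lcdLine-count (suc n))
          , subst (NumClasses _) (2∣⇒⌈n/2⌉≡n/2 2∣) (lcdHyperplane-count 1≤n))
  , (λ _ → subst (NumClasses _) (⌈n/2⌉≡[n+1]/2 (suc n)) (lcdLine-count (suc n))
         , subst (NumClasses _) (⌈n/2⌉≡[n+1]/2 (suc n)) (lcdHyperplane-count 1≤n))
  , (λ _ → subst (NumClasses _) (⌊n/2⌋≡n/2 (suc n)) (lcdHyperplane-distance₁-count 1≤n))
  , (λ ∤ → subst (NumClasses _) (2∣⇒⌈n/2⌉≡n/2 (even⇒2∣ (not-injective (∤⇒odd ∤))))
                 (lcdHyperplane-distance₁-count 1≤n))
  , (λ ∤ → lcdHyperplane-distance₂-count 1≤n (∤⇒odd ∤))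
  , (λ d excluded → numClasses-none λ C lcd → excluded (distance-admissible (lcdHyperplane-distance 1≤n lcd)))
  where
  open import Data.Bool.Properties using (not-injective)
  open import Data.Nat.Properties using (m≤n⇒m≤1+n)
  open import Data.Product using (_,_; uncurry)
  open import Relation.Binary.PropositionalEquality using (subst)
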